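{- Let $\mathcal{S}=(a_{n,m})_{n,m\geq 0}$ be an infinite matrix of complex numbers satisfying $a_{n+1,m}=a_{n,m+1}+m\,a_{n,m}$ for all $n,m\geq 0$, and let $b_n=a_{n,0}$. Then for every $n\geq 0$, $$\det\left(a_{i,j}\right)_{0\leq i,j\leq n}=\det\left(b_{i+j}\right)_{0\leq i,j\leq n}.$$ -}

module Defs where

open import Level using (Level)
open import Algebra.Bundles using (CommutativeRing)
open import Data.Nat using (ℕ; zero; suc)
open import Data.Fin using (Fin; zero; suc; punchIn)

module _ {c ℓ : Level} (R : CommutativeRing c ℓ) where
  open CommutativeRing R using (Carrier; _+_; _*_; -_; 0#; 1#)

  fromℕ : ℕ → Carrier
  fromℕ zero    = 0#
  fromℕ (suc m) = 1# + fromℕ m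

  sumFin : (n : ℕ) → (Fin n → Carrier) → Carrier
  sumFin zero    f = 0#
  sumFin (suc n) f = f zero + sumFin n (λ i → f (suc i))

  sign : {n : ℕ} → Fin n → Carrier
  sign zero    = 1#
  sign (suc j) = - sign j

  minor : {n : ℕ} → (Fin (suc n) → Fin (suc n) → Carrier) → Fin (suc n) → Fin n → Fin n → Carrier
  minor M j r k = M (suc r) (punchIn j k)

  det : (n : ℕ) → (Fin n → Fin n → Carrier) → Carrier
  det zero    M = 1#
  det (suc n) M = sumFin (suc n) (λ j → sign j * (M zero j * det n (minor M j)))

-- Adding a multiple of a column to the adjacent one leaves a determinant unchanged. Let A₀ = (a n m)
-- and let Aₜ have columns m ≤ t equal to (b (n + m))ₙ and columns m > t equal to (a (n + t) (m − t))ₙ.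
-- By the recurrence, Aₜ₊₁ arises from Aₜ by adding (m − 1 − t) times column m − 1 to column m for
-- every m > t; done from right to left, each step adds a column not yet modified. So det Aₜ does not
-- depend on t, and the leading (n+1)×(n+1) block of Aₙ is the Hankel matrix (b (i + j)).
module Submission where

open import Defs
open import Algebra.Bundles using (CommutativeRing)
open import Level using (Level)
open import Data.Nat using (ℕ; zero; suc; _+_; _∸_; _≤_; _<_; s≤s; _<?_; s<s⁻¹)
import Data.Nat.Properties as ℕ
open import Data.Fin using (Fin; zero; suc; toℕ; punchIn; punchOut; fromℕ<; _≟_)
open import Data.Fin.Properties
  using (toℕ-injective; toℕ-fromℕ<; toℕ<n; punchIn-injective; punchIn-punchOut; punchInᵢ≢i; suc-injective)
open import Data.Vec.Functional using (updateAt)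
open import Data.Vec.Functional.Properties using (updateAt-updates; updateAt-minimal)
open import Data.Sum using (_⊎_; inj₁; inj₂)
open import Data.Product using (_×_; _,_)
open import Function using (_∘_)
open import Relation.Nullary using (yes; no; contradiction)
open import Relation.Binary.PropositionalEquality as ≡ using (_≡_; _≢_; refl; cong)

data Adjacent : {n : ℕ} → Fin n → Fin n → Set where
  zero-one : ∀ {n} → Adjacent {suc (suc n)} zero (suc zero)
  suc-suc  : ∀ {n} {x y : Fin n} → Adjacent x y → Adjacent (suc x) (suc y)

adjacent⇒≢ : ∀ {n} {x y : Fin n} → Adjacent x y → x ≢ y
adjacent⇒≢ zero-one      ()
adjacent⇒≢ (suc-suc x⋖y) refl = adjacent⇒≢ x⋖y refl

adjacent-fromℕ< : ∀ {s n} .(s<n : s < n) (s+1<n : suc s < n) → Adjacent (fromℕ< s<n) (fromℕ< s+1<n)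
adjacent-fromℕ< {zero}  {suc zero}    _   (s≤s ())
adjacent-fromℕ< {zero}  {suc (suc n)} _   _           = zero-one
adjacent-fromℕ< {suc s} {suc n}       s<n (s≤s s+1<n) = suc-suc (adjacent-fromℕ< (s<s⁻¹ s<n) s+1<n)

punchOut-adjacent : ∀ {n} {x y j : Fin (suc n)} → Adjacent x y → (j≢x : j ≢ x) (j≢y : j ≢ y) →
                    Adjacent (punchOut j≢x) (punchOut j≢y)
punchOut-adjacent               {j = zero}        zero-one      j≢x j≢y = contradiction refl j≢x
punchOut-adjacent               {j = suc zero}    zero-one      j≢x j≢y = contradiction refl j≢y
punchOut-adjacent {suc (suc n)} {j = suc (suc j)} zero-one      j≢x j≢y = zero-one
punchOut-adjacent               {j = zero}        (suc-suc x⋖y) j≢x j≢y = x⋖y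
punchOut-adjacent {suc n}       {j = suc j}       (suc-suc x⋖y) j≢x j≢y =
  suc-suc (punchOut-adjacent x⋖y (j≢x ∘ cong suc) (j≢y ∘ cong suc))

punchIn-adjacent : ∀ {n} {x y : Fin (suc n)} → Adjacent x y → ∀ l →
                   punchIn x l ≡ punchIn y l ⊎ (punchIn x l ≡ y × punchIn y l ≡ x)
punchIn-adjacent zero-one      zero    = inj₂ (refl , refl)
punchIn-adjacent zero-one      (suc l) = inj₁ refl
punchIn-adjacent (suc-suc x⋖y) zero    = inj₁ refl
punchIn-adjacent (suc-suc x⋖y) (suc l) with punchIn-adjacent x⋖y l
... | inj₁ eq          = inj₁ (cong suc eq)
... | inj₂ (eq₁ , eq₂) = inj₂ (cong suc eq₁ , cong suc eq₂)

punchIn≡⇒≡punchOut : ∀ {n} {j k : Fin (suc n)} (j≢k : j ≢ k) l → punchIn j l ≡ k → l ≡ punchOut j≢k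
punchIn≡⇒≡punchOut {j = j} j≢k l eq = punchIn-injective j l _ (≡.trans eq (≡.sym (punchIn-punchOut j≢k)))

module _ {c ℓ : Level} (R : CommutativeRing c ℓ) where
  open CommutativeRing R renaming (_+_ to _⊕_; refl to ≈-refl) hiding (zero)
  open import Relation.Binary.Reasoning.Setoid setoid
  open import Algebra.Properties.Ring ring using (-‿distribˡ-*)
  open import Algebra.Properties.CommutativeSemigroup +-commutativeSemigroup using (interchange)
  open import Algebra.Properties.CommutativeSemigroup *-commutativeSemigroup using (x∙yz≈y∙xz)

  Matrix : ℕ → Set c
  Matrix n = Fin n → Fin n → Carrier

  combination-*ˡ : ∀ s {x y z} κ → x ≈ y ⊕ κ * z → s * x ≈ s * y ⊕ κ * (s * z)
  combination-*ˡ s {x} {y} {z} κ x≈y+κz = begin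
    s * x               ≈⟨ *-congˡ x≈y+κz ⟩
    s * (y ⊕ κ * z)     ≈⟨ distribˡ s y (κ * z) ⟩
    s * y ⊕ s * (κ * z) ≈⟨ +-congˡ (x∙yz≈y∙xz s κ z) ⟩
    s * y ⊕ κ * (s * z) ∎

  combination-*ʳ : ∀ s {x y z} κ → x ≈ y ⊕ κ * z → x * s ≈ y * s ⊕ κ * (z * s)
  combination-*ʳ s {x} {y} {z} κ x≈y+κz = begin
    x * s               ≈⟨ *-comm x s ⟩
    s * x               ≈⟨ combination-*ˡ s κ x≈y+κz ⟩
    s * y ⊕ κ * (s * z) ≈⟨ +-cong (*-comm s y) (*-congˡ (*-comm s z)) ⟩
    y * s ⊕ κ * (z * s) ∎

  sumFin-cong : ∀ n {f g : Fin n → Carrier} → (∀ j → f j ≈ g j) → sumFin R n f ≈ sumFin R n g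
  sumFin-cong zero    f≈g = ≈-refl
  sumFin-cong (suc n) f≈g = +-cong (f≈g zero) (sumFin-cong n (f≈g ∘ suc))

  sumFin-zero : ∀ n {f : Fin n → Carrier} → (∀ j → f j ≈ 0#) → sumFin R n f ≈ 0#
  sumFin-zero zero    f≈0 = ≈-refl
  sumFin-zero (suc n) f≈0 = trans (+-cong (f≈0 zero) (sumFin-zero n (f≈0 ∘ suc))) (+-identityˡ 0#)

  sumFin-combination : ∀ n κ {f g h : Fin n → Carrier} → (∀ j → f j ≈ g j ⊕ κ * h j) →
                       sumFin R n f ≈ sumFin R n g ⊕ κ * sumFin R n h
  sumFin-combination zero    κ f≈g+κh = sym (trans (+-congˡ (zeroʳ κ)) (+-identityʳ 0#))
  sumFin-combination (suc n) κ {f} {g} {h} f≈g+κh = begin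
    f zero ⊕ sumFin R n (f ∘ suc)
      ≈⟨ +-cong (f≈g+κh zero) (sumFin-combination n κ (f≈g+κh ∘ suc)) ⟩
    (g zero ⊕ κ * h zero) ⊕ (sumFin R n (g ∘ suc) ⊕ κ * sumFin R n (h ∘ suc))
      ≈⟨ interchange _ _ _ _ ⟩
    (g zero ⊕ sumFin R n (g ∘ suc)) ⊕ (κ * h zero ⊕ κ * sumFin R n (h ∘ suc))
      ≈⟨ +-congˡ (distribˡ κ _ _) ⟨
    (g zero ⊕ sumFin R n (g ∘ suc)) ⊕ κ * (h zero ⊕ sumFin R n (h ∘ suc)) ∎

  sumFin-adjacent-cancel : ∀ {n} {x y : Fin n} → Adjacent x y → (f : Fin n → Carrier) →
                           (∀ j → j ≢ x → j ≢ y → f j ≈ 0#) → f x ⊕ f y ≈ 0# → sumFin R n f ≈ 0#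
  sumFin-adjacent-cancel {suc (suc n)} zero-one f f≈0 fx+fy≈0 = begin
    f zero ⊕ (f (suc zero) ⊕ sumFin R n (λ j → f (suc (suc j))))
      ≈⟨ +-assoc _ _ _ ⟨
    (f zero ⊕ f (suc zero)) ⊕ sumFin R n (λ j → f (suc (suc j)))
      ≈⟨ +-cong fx+fy≈0 (sumFin-zero n (λ j → f≈0 (suc (suc j)) (λ ()) (λ ()))) ⟩
    0# ⊕ 0#
      ≈⟨ +-identityˡ 0# ⟩
    0# ∎
  sumFin-adjacent-cancel (suc-suc x⋖y) f f≈0 fx+fy≈0 = begin
    f zero ⊕ sumFin R _ (f ∘ suc) ≈⟨ +-cong (f≈0 zero (λ ()) (λ ()))
                                       (sumFin-adjacent-cancel x⋖y (f ∘ suc)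
                                         (λ j j≢x j≢y → f≈0 (suc j) (j≢x ∘ suc-injective) (j≢y ∘ suc-injective))
                                         fx+fy≈0) ⟩
    0# ⊕ 0#                       ≈⟨ +-identityˡ 0# ⟩
    0#                            ∎

  sign-adjacent : ∀ {n} {x y : Fin n} → Adjacent x y → sign R y ≡ - sign R x
  sign-adjacent zero-one      = refl
  sign-adjacent (suc-suc x⋖y) = cong -_ (sign-adjacent x⋖y)

  det-cong : ∀ n {M N : Matrix n} → (∀ i j → M i j ≈ N i j) → det R n M ≈ det R n N
  det-cong zero    M≈N = ≈-refl
  det-cong (suc n) M≈N = sumFin-cong (suc n) λ j →
    *-congˡ {sign R j} (*-cong (M≈N zero j) (det-cong n (λ r k → M≈N (suc r) (punchIn j k))))

  det-combination-column : ∀ n (k : Fin n) κ {M M₁ M₂ : Matrix n} →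
                           (∀ i l → l ≢ k → M i l ≈ M₁ i l) → (∀ i l → l ≢ k → M i l ≈ M₂ i l) →
                           (∀ i → M i k ≈ M₁ i k ⊕ κ * M₂ i k) →
                           det R n M ≈ det R n M₁ ⊕ κ * det R n M₂
  det-combination-column (suc n) k κ {M} {M₁} {M₂} M≈M₁ M≈M₂ Mk≈ = sumFin-combination (suc n) κ term
    where
    term : ∀ j → sign R j * (M zero j * det R n (minor R M j)) ≈
                 sign R j * (M₁ zero j * det R n (minor R M₁ j)) ⊕ κ * (sign R j * (M₂ zero j * det R n (minor R M₂ j)))
    term j with j ≟ k
    ... | yes refl = combination-*ˡ (sign R j) κ (begin
      M zero j * det R n (minor R M j)
        ≈⟨ combination-*ʳ (det R n (minor R M j)) κ (Mk≈ zero) ⟩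
      M₁ zero j * det R n (minor R M j) ⊕ κ * (M₂ zero j * det R n (minor R M j))
        ≈⟨ +-cong (*-congˡ (minor-det M≈M₁)) (*-congˡ (*-congˡ (minor-det M≈M₂))) ⟩
      M₁ zero j * det R n (minor R M₁ j) ⊕ κ * (M₂ zero j * det R n (minor R M₂ j)) ∎)
      where
      minor-det : ∀ {N} → (∀ i l → l ≢ j → M i l ≈ N i l) → det R n (minor R M j) ≈ det R n (minor R N j)
      minor-det M≈N = det-cong n (λ r l → M≈N (suc r) (punchIn j l) (punchInᵢ≢i j l))
    ... | no j≢k = combination-*ˡ (sign R j) κ (begin
      M zero j * det R n (minor R M j)
        ≈⟨ combination-*ˡ (M zero j) κ minors ⟩
      M zero j * det R n (minor R M₁ j) ⊕ κ * (M zero j * det R n (minor R M₂ j))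
        ≈⟨ +-cong (*-congʳ (M≈M₁ zero j j≢k)) (*-congˡ (*-congʳ (M≈M₂ zero j j≢k))) ⟩
      M₁ zero j * det R n (minor R M₁ j) ⊕ κ * (M₂ zero j * det R n (minor R M₂ j)) ∎)
      where
      avoids : ∀ {N} → (∀ i l → l ≢ k → M i l ≈ N i l) → ∀ r l → l ≢ punchOut j≢k → minor R M j r l ≈ minor R N j r l
      avoids M≈N r l l≢k′ = M≈N (suc r) (punchIn j l) (l≢k′ ∘ punchIn≡⇒≡punchOut j≢k l)
      minors : det R n (minor R M j) ≈ det R n (minor R M₁ j) ⊕ κ * det R n (minor R M₂ j)
      minors = det-combination-column n (punchOut j≢k) κ (avoids M≈M₁) (avoids M≈M₂) λ r →
        ≡.subst (λ l → M (suc r) l ≈ M₁ (suc r) l ⊕ κ * M₂ (suc r) l) (≡.sym (punchIn-punchOut j≢k)) (Mk≈ (suc r))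

  det-adjacent-equal-columns : ∀ n {M : Matrix n} {x y} → Adjacent x y → (∀ i → M i x ≈ M i y) → det R n M ≈ 0#
  det-adjacent-equal-columns (suc n) {M} {x} {y} x⋖y Mx≈My = sumFin-adjacent-cancel x⋖y _ others pair
    where
    term : Fin (suc n) → Carrier
    term j = sign R j * (M zero j * det R n (minor R M j))
    others : ∀ j → j ≢ x → j ≢ y → term j ≈ 0#
    others j j≢x j≢y = begin
      term j                     ≈⟨ *-congˡ (*-congˡ (det-adjacent-equal-columns n (punchOut-adjacent x⋖y j≢x j≢y) λ i →
                                  ≡.subst₂ (λ u v → M (suc i) u ≈ M (suc i) v)
                                    (≡.sym (punchIn-punchOut j≢x)) (≡.sym (punchIn-punchOut j≢y)) (Mx≈My (suc i)))) ⟩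
      sign R j * (M zero j * 0#) ≈⟨ *-congˡ (zeroʳ _) ⟩
      sign R j * 0#              ≈⟨ zeroʳ _ ⟩
      0#                         ∎
    same-minor : ∀ r l → minor R M y r l ≈ minor R M x r l
    same-minor r l with punchIn-adjacent x⋖y l
    ... | inj₁ eq          = reflexive (cong (M (suc r)) (≡.sym eq))
    ... | inj₂ (eq₁ , eq₂) = ≡.subst₂ (λ u v → M (suc r) u ≈ M (suc r) v) (≡.sym eq₂) (≡.sym eq₁) (Mx≈My (suc r))
    pair : term x ⊕ term y ≈ 0#
    pair = begin
      term x ⊕ term y
        ≈⟨ +-congˡ (*-cong (reflexive (sign-adjacent x⋖y)) (*-cong (sym (Mx≈My zero)) (det-cong n same-minor))) ⟩
      term x ⊕ (- sign R x) * (M zero x * det R n (minor R M x))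
        ≈⟨ +-congˡ (-‿distribˡ-* _ _) ⟨
      term x ⊕ - term x
        ≈⟨ -‿inverseʳ _ ⟩
      0# ∎

  det-add-adjacent-column : ∀ n {M M′ : Matrix n} {x y} → Adjacent x y → (κ : Carrier) →
                            (∀ i l → l ≢ y → M′ i l ≈ M i l) → (∀ i → M′ i y ≈ M i y ⊕ κ * M i x) →
                            det R n M′ ≈ det R n M
  det-add-adjacent-column n {M} {M′} {x} {y} x⋖y κ M′≈M M′y≈ = begin
    det R n M′                 ≈⟨ det-combination-column n y κ M′≈M M′≈Mₓ M′y≈My+κMₓy ⟩
    det R n M ⊕ κ * det R n Mₓ ≈⟨ +-congˡ (*-congˡ (det-adjacent-equal-columns n x⋖y Mₓx≈Mₓy)) ⟩
    det R n M ⊕ κ * 0#         ≈⟨ +-congˡ (zeroʳ κ) ⟩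
    det R n M ⊕ 0#             ≈⟨ +-identityʳ _ ⟩
    det R n M                  ∎
    where
    Mₓ : Matrix n
    Mₓ i = updateAt (M i) y (λ _ → M i x)
    M′≈Mₓ : ∀ i l → l ≢ y → M′ i l ≈ Mₓ i l
    M′≈Mₓ i l l≢y = trans (M′≈M i l l≢y) (reflexive (≡.sym (updateAt-minimal l y (M i) l≢y)))
    M′y≈My+κMₓy : ∀ i → M′ i y ≈ M i y ⊕ κ * Mₓ i y
    M′y≈My+κMₓy i = trans (M′y≈ i) (+-congˡ (*-congˡ (reflexive (≡.sym (updateAt-updates y (M i))))))
    Mₓx≈Mₓy : ∀ i → Mₓ i x ≈ Mₓ i y
    Mₓx≈Mₓy i = reflexive (≡.trans (updateAt-minimal x y (M i) (adjacent⇒≢ x⋖y)) (≡.sym (updateAt-updates y (M i))))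

  leading : ∀ {N} → (ℕ → ℕ → Carrier) → Matrix N
  leading f i j = f (toℕ i) (toℕ j)

  det-leading-add-previous-column : ∀ N (f g : ℕ → ℕ → Carrier) s κ →
                                    (∀ n m → m ≢ suc s → g n m ≈ f n m) → (∀ n → g n (suc s) ≈ f n (suc s) ⊕ κ * f n s) →
                                    det R N (leading g) ≈ det R N (leading f)
  det-leading-add-previous-column N f g s κ g≈f g≈f+κf with suc s <? N
  ... | no s+1≮N = det-cong N λ i j → g≈f _ _ λ j≡s+1 → s+1≮N (≡.subst (_< N) j≡s+1 (toℕ<n j))
  ... | yes s+1<N = det-add-adjacent-column N (adjacent-fromℕ< s<N s+1<N) κ
                      (λ i l l≢y → g≈f _ _ (l≢y ∘ toℕ≡⇒≡y l)) column
    where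
    s<N : s < N
    s<N = ℕ.<-trans (ℕ.n<1+n s) s+1<N
    toℕ≡⇒≡y : ∀ l → toℕ l ≡ suc s → l ≡ fromℕ< s+1<N
    toℕ≡⇒≡y l eq = toℕ-injective (≡.trans eq (≡.sym (toℕ-fromℕ< s+1<N)))
    column : ∀ i → leading g i (fromℕ< s+1<N) ≈ leading f i (fromℕ< s+1<N) ⊕ κ * leading f i (fromℕ< s<N)
    column i rewrite toℕ-fromℕ< s+1<N | toℕ-fromℕ< s<N = g≈f+κf (toℕ i)

  shearFrom : ℕ → (ℕ → Carrier) → (ℕ → Carrier) → ℕ → Carrier
  shearFrom zero    c r zero    = r zero
  shearFrom zero    c r (suc j) = r (suc j) ⊕ c j * r j
  shearFrom (suc k) c r zero    = r zero
  shearFrom (suc k) c r (suc j) = shearFrom k (c ∘ suc) (r ∘ suc) j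

  shearFrom-≤ : ∀ {k m} c r → m ≤ k → shearFrom k c r m ≡ r m
  shearFrom-≤ {zero}  {zero}  c r _         = refl
  shearFrom-≤ {suc k} {zero}  c r _         = refl
  shearFrom-≤ {suc k} {suc m} c r (s≤s m≤k) = shearFrom-≤ (c ∘ suc) (r ∘ suc) m≤k

  shearFrom-≢ : ∀ k {m} c r → m ≢ suc k → shearFrom k c r m ≡ shearFrom (suc k) c r m
  shearFrom-≢ zero    {zero}        c r _ = refl
  shearFrom-≢ zero    {suc zero}    c r m≢1 = contradiction refl m≢1
  shearFrom-≢ zero    {suc (suc m)} c r _ = refl
  shearFrom-≢ (suc k) {zero}        c r _ = refl
  shearFrom-≢ (suc k) {suc m}       c r m≢k+2 = shearFrom-≢ k (c ∘ suc) (r ∘ suc) (m≢k+2 ∘ cong suc)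

  shearFrom-suc : ∀ k c r → shearFrom k c r (suc k) ≡ shearFrom (suc k) c r (suc k) ⊕ c k * shearFrom (suc k) c r k
  shearFrom-suc zero    c r = refl
  shearFrom-suc (suc k) c r = shearFrom-suc k (c ∘ suc) (r ∘ suc)

  det-leading-shearFrom : ∀ N k c (f : ℕ → ℕ → Carrier) → det R N (leading (λ n → shearFrom k c (f n))) ≈ det R N (leading f)
  det-leading-shearFrom N k c f = from-sheared N k (ℕ.m≤m+n N k)
    where
    sheared : ℕ → ℕ → ℕ → Carrier
    sheared k n = shearFrom k c (f n)
    from-sheared : ∀ j k → N ≤ j + k → det R N (leading (sheared k)) ≈ det R N (leading f)
    from-sheared zero    k N≤k = det-cong N λ i l →
      reflexive (shearFrom-≤ c (f (toℕ i)) (ℕ.<⇒≤ (ℕ.<-≤-trans (toℕ<n l) N≤k)))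
    from-sheared (suc j) k N≤j+1+k = trans
      (det-leading-add-previous-column N (sheared (suc k)) (sheared k) k (c k)
        (λ n m m≢k+1 → reflexive (shearFrom-≢ k c (f n) m≢k+1)) (λ n → reflexive (shearFrom-suc k c (f n))))
      (from-sheared j (suc k) (≡.subst (N ≤_) (≡.sym (ℕ.+-suc j k)) N≤j+1+k))

  module _ (a : ℕ → ℕ → Carrier) where

    -- hankelUpTo t is the matrix Aₜ: a (n + m) 0 for m ≤ t and a (n + t) (m ∸ t) otherwise.
    hankelUpTo : ℕ → ℕ → ℕ → Carrier
    hankelUpTo zero              = a
    hankelUpTo (suc t) n zero    = a n 0
    hankelUpTo (suc t) n (suc m) = hankelUpTo t (suc n) m

    hankelUpTo-≤ : ∀ {t m} n → m ≤ t → hankelUpTo t n m ≡ a (n + m) 0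
    hankelUpTo-≤ {zero}  {zero}  n _         = cong (λ k → a k 0) (≡.sym (ℕ.+-identityʳ n))
    hankelUpTo-≤ {suc t} {zero}  n _         = cong (λ k → a k 0) (≡.sym (ℕ.+-identityʳ n))
    hankelUpTo-≤ {suc t} {suc m} n (s≤s m≤t) = ≡.trans (hankelUpTo-≤ (suc n) m≤t) (cong (λ k → a k 0) (≡.sym (ℕ.+-suc n m)))

    module _ (recurrence : ∀ n m → a (suc n) m ≈ a n (suc m) ⊕ fromℕ R m * a n m) where

      hankelUpTo-suc : ∀ t n m → hankelUpTo (suc t) n m ≈ shearFrom t (λ j → fromℕ R (j ∸ t)) (hankelUpTo t n) m
      hankelUpTo-suc zero    n zero    = ≈-refl
      hankelUpTo-suc zero    n (suc m) = recurrence n m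
      hankelUpTo-suc (suc t) n zero    = ≈-refl
      hankelUpTo-suc (suc t) n (suc m) = hankelUpTo-suc t (suc n) m

      det-leading-hankelUpTo : ∀ N t → det R N (leading a) ≈ det R N (leading (hankelUpTo t))
      det-leading-hankelUpTo N zero    = ≈-refl
      det-leading-hankelUpTo N (suc t) = begin
        det R N (leading a)
          ≈⟨ det-leading-hankelUpTo N t ⟩
        det R N (leading (hankelUpTo t))
          ≈⟨ det-leading-shearFrom N t _ (hankelUpTo t) ⟨
        det R N (leading (λ n → shearFrom t (λ j → fromℕ R (j ∸ t)) (hankelUpTo t n)))
          ≈⟨ det-cong N (λ i j → sym (hankelUpTo-suc t (toℕ i) (toℕ j))) ⟩
        det R N (leading (hankelUpTo (suc t))) ∎

theorem5 : ∀ {c ℓ} (R : CommutativeRing c ℓ) → let open CommutativeRing R renaming (_+_ to _⊕_) in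
    (a : ℕ → ℕ → Carrier) →
    (∀ n m → a (suc n) m ≈ (a n (suc m) ⊕ (fromℕ R m * a n m))) →
    ∀ n → det R (suc n) (λ i j → a (toℕ i) (toℕ j)) ≈ det R (suc n) (λ i j → a (toℕ i + toℕ j) 0)
theorem5 R a recurrence n = trans
  (det-leading-hankelUpTo R a recurrence (suc n) n)
  (det-cong R (suc n) λ i j → reflexive (hankelUpTo-≤ R a (toℕ i) (ℕ.≤-pred (toℕ<n j))))
  where open CommutativeRing R using (trans; reflexive)
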